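{- Let $\Delta$ be a shellable $d$-dimensional simplicial complex with $d+3$ vertices. Then $\Delta$ is vertex decomposable.
   Context: A simplicial complex is a family of subsets of a finite set closed under taking subsets; facets are maximal faces; vertices are $v$ with $\{v\}\in\Delta$. A pure $d$-dimensional complex is shellable if its facets can be ordered $F_1,\dots,F_s$ so that for each $k\ge 2$ the complex generated by the sets $F_i\cap F_k$, $i<k$, is pure of dimension $d-1$. A simplex is a complex $2^W$ (including $\emptyset$ and $\{\emptyset\}$). $\mathrm{lk}_\Delta(v)=\{G\in\Delta: v\notin G,\ G\cup\{v\}\in\Delta\}$, $\mathrm{del}_\Delta(v)=\{G\in\Delta: v\notin G\}$. $\Delta$ is vertex decomposable if it is a simplex, or it has a vertex $v$ such that $\mathrm{del}_\Delta(v)$ and $\mathrm{lk}_\Delta(v)$ are vertex decomposable and every facet of $\mathrm{del}_\Delta(v)$ is a facet of $\Delta$. -}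

module Defs where

open import Data.Bool using (Bool; true; false; not; _∧_; T)
open import Data.Nat using (ℕ; suc; _<_; _≤_)
open import Data.Fin using (Fin; toℕ)
open import Data.Fin.Subset using (Subset; _⊆_; _∩_; _∪_; ⁅_⁆; ∣_∣)
open import Data.Vec using (lookup; tabulate)
open import Data.List using (List; length)
import Data.List as L
open import Data.List.Membership.Propositional using (_∈_)
open import Data.List.Relation.Unary.Unique.Propositional using (Unique)
open import Data.Product using (Σ; ∃; _×_)
open import Data.Sum using (_⊎_)
open import Relation.Nullary using (¬_)
open import Relation.Binary.PropositionalEquality using (_≡_)
open import Function.Bundles using (_⇔_)

-- A (finite) family of subsets of the ground set Fin n, given by a
-- decidable (Bool-valued) membership test.  Faces are the G with T (Δ G).
Complex : ℕ → Set
Complex n = Subset n → Bool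

Face : ∀ {n} → Complex n → Subset n → Set
Face Δ G = T (Δ G)

IsComplex : ∀ {n} → Complex n → Set
IsComplex {n} Δ = ∀ (F G : Subset n) → G ⊆ F → Face Δ F → Face Δ G

Facet : ∀ {n} → (Subset n → Set) → Subset n → Set
Facet {n} P F = P F × (∀ (G : Subset n) → P G → F ⊆ G → G ≡ F)

-- pure of dimension d, expressed with s = d + 1 = size of the facets:
-- every facet has s elements and there is a face with s elements
-- (so the dimension is exactly d).
PureOfSize : ∀ {n} → ℕ → (Subset n → Set) → Set
PureOfSize {n} s P =
  (∀ (F : Subset n) → Facet P F → ∣ F ∣ ≡ s) × (Σ (Subset n) λ F → P F × ∣ F ∣ ≡ s)

vertexSet : ∀ {n} → Complex n → Subset n
vertexSet Δ = tabulate (λ v → Δ ⁅ v ⁆)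

generatedBefore : ∀ {n} (Fs : List (Subset n)) → Fin (length Fs) → Subset n → Set
generatedBefore Fs k G =
  Σ (Fin (length Fs)) λ i → (toℕ i < toℕ k) × (G ⊆ (L.lookup Fs i ∩ L.lookup Fs k))

Shellable : ∀ {n} → ℕ → Complex n → Set
Shellable {n} d Δ =
  PureOfSize (suc d) (Face Δ) ×
  (Σ (List (Subset n)) λ Fs →
      Unique Fs
    × (∀ (F : Subset n) → (F ∈ Fs) ⇔ Facet (Face Δ) F)
    × (∀ (k : Fin (length Fs)) → 1 ≤ toℕ k → PureOfSize d (generatedBefore Fs k)))

lk : ∀ {n} → Complex n → Fin n → Complex n
lk Δ v G = not (lookup G v) ∧ Δ (G ∪ ⁅ v ⁆)

del : ∀ {n} → Complex n → Fin n → Complex n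
del Δ v G = not (lookup G v) ∧ Δ G

-- simplex 2^W, including the void complex ∅ and {∅}
IsSimplex : ∀ {n} → Complex n → Set
IsSimplex {n} Δ =
  (∀ (G : Subset n) → ¬ Face Δ G) ⊎
  (Σ (Subset n) λ W → ∀ (G : Subset n) → Face Δ G ⇔ (G ⊆ W))

data VertexDecomposable {n : ℕ} : Complex n → Set where
  simplex : ∀ {Δ} → IsSimplex Δ → VertexDecomposable Δ
  decomp  : ∀ {Δ} (v : Fin n) → Face Δ ⁅ v ⁆ →
            VertexDecomposable (del Δ v) →
            VertexDecomposable (lk Δ v) →
            (∀ (F : Subset n) → Facet (Face (del Δ v)) F → Facet (Face Δ) F) →
            VertexDecomposable Δ

{-# OPTIONS --safe #-}

-- The complements S ─ F of the facets F of Δ in its vertex set S have two elements, so they are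
-- the edges of a graph on S, and the faces of Δ are the subsets of S avoiding some edge.  A
-- shelling turns into an order of the edges in which an edge disjoint from an older one is joined
-- to it by a third, older edge.  In such a graph every vertex has a shedding neighbour v: each
-- edge missing v contains a neighbour of v.  The deletion of v is generated by the sets S - v - u,
-- u a neighbour of v, which is vertex decomposable one vertex at a time, and the link of v is the
-- complex of the graph without the edges at v, again in shelling order; induction does the rest.

module Submission where

open import Defs
open import Data.Nat using (ℕ; _+_)
open import Data.Fin.Subset using (∣_∣)
open import Relation.Binary.PropositionalEquality using (_≡_)

open import Data.Bool using (true; false; not; _∧_; T)
open import Data.Bool.Properties using (T-≡)
open import Data.Empty using (⊥; ⊥-elim)
open import Data.Unit using (⊤; tt)
open import Data.Nat using (zero; suc; _≤_; _<_; z≤n; s≤s)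
import Data.Nat.Properties as ℕ
open import Data.Fin using (Fin; toℕ; zero; suc)
open import Data.Fin.Properties using (_≟_; any?)
open import Data.Fin.Subset using (Subset; Nonempty; _∈_; _∉_; _⊆_; _∩_; _∪_; _─_; _-_; ⁅_⁆; inside; outside)
open import Data.Fin.Subset.Properties
  using (_∈?_; _⊆?_; _⊂?_; anySubset?; ⊆-antisym; x∈⁅x⁆; x∈⁅y⁆⇒x≡y; x∉⁅y⁆⇒x≢y; ∣⁅x⁆∣≡1; ∣p∣≤n;
         x∈p∪q⁺; x∈p∪q⁻; x∈p∩q⁺; x∈p∩q⁻; x∈p∧x∉q⇒x∈p─q; x∈p∧x≢y⇒x∈p-y; x∈p⇒∣p-x∣<∣p∣;
         p⊂q⇒∣p∣<∣q∣)
import Data.Vec.Base as Vec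
open import Data.Vec using (_∷_; []; lookup)
open import Data.Vec.Properties using (lookup∘tabulate; []=⇒lookup; lookup⇒[]=)
open import Data.List using (List; []; _∷_; length; filter; map; reverse; reverseAcc)
import Data.List as List
open import Data.List.Properties using (length-filter; filter-notAll)
open import Data.List.Membership.Propositional using (find; lose) renaming (_∈_ to _∈ₗ_)
open import Data.List.Membership.Propositional.Properties using (∈-filter⁺; ∈-filter⁻; ∈-map⁺; ∈-map⁻; ∈-lookup)
open import Data.List.Relation.Unary.Any using (here; there)
import Data.List.Relation.Unary.Any as Any
import Data.List.Relation.Unary.Any.Properties as Any
open import Data.List.Relation.Unary.All using (All; []; _∷_)
import Data.List.Relation.Unary.All as All
import Data.List.Relation.Unary.All.Properties as All
open import Data.List.Relation.Unary.AllPairs using (_∷_)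
open import Data.List.Relation.Unary.Unique.Propositional using (Unique)
open import Data.Product using (∃; ∃₂; _×_; _,_; proj₁; proj₂)
open import Data.Sum using (_⊎_; inj₁; inj₂; [_,_]′)
open import Function using (_∘_)
open import Function.Bundles using (_⇔_; mk⇔; Equivalence)
open import Relation.Nullary using (¬_; Dec; yes; no; ¬?; _×-dec_; _⊎-dec_; _→-dec_)
open import Relation.Nullary.Decidable using (map′; T?)
open import Relation.Unary using (Decidable; _≐′_)
open import Relation.Binary.PropositionalEquality using (refl; sym; trans; cong; cong₂; subst; _≢_)

open Equivalence using (to; from)

private
  variable
    n : ℕ

-- Subsets

x∈p─q⁻ : ∀ {x : Fin n} {p q : Subset n} → x ∈ p ─ q → x ∈ p × x ∉ q
x∈p─q⁻ {x = zero}  {inside ∷ p} {outside ∷ q} Vec.here = Vec.here , λ ()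
x∈p─q⁻ {x = suc x} {_ ∷ p}      {_ ∷ q}       (Vec.there x∈) =
  let x∈p , x∉q = x∈p─q⁻ {p = p} {q} x∈ in Vec.there x∈p , λ { (Vec.there x∈q) → x∉q x∈q }

x∈p-y⁻ : ∀ {x y : Fin n} {p : Subset n} → x ∈ p - y → x ∈ p × x ≢ y
x∈p-y⁻ {y = y} {p} x∈ = let x∈p , x∉⁅y⁆ = x∈p─q⁻ {p = p} {⁅ y ⁆} x∈ in x∈p , x∉⁅y⁆⇒x≢y x∉⁅y⁆

x∈p∪⁅y⁆⁻ : ∀ {x y : Fin n} (p : Subset n) → x ∈ p ∪ ⁅ y ⁆ → x ∈ p ⊎ x ≡ y
x∈p∪⁅y⁆⁻ {y = y} p x∈ = [ inj₁ , inj₂ ∘ x∈⁅y⁆⇒x≡y y ]′ (x∈p∪q⁻ p ⁅ y ⁆ x∈)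

p⊆q-x⇒x∉p : ∀ {x : Fin n} {p q : Subset n} → p ⊆ q - x → x ∉ p
p⊆q-x⇒x∉p p⊆q-x x∈p = proj₂ (x∈p-y⁻ (p⊆q-x x∈p)) refl

p⊆q⇒p⊆q-x : ∀ {x : Fin n} {p q : Subset n} → p ⊆ q → x ∉ p → p ⊆ q - x
p⊆q⇒p⊆q-x p⊆q x∉p y∈p = x∈p∧x≢y⇒x∈p-y (p⊆q y∈p) λ { refl → x∉p y∈p }

p⊆q-x⇒p∪⁅x⁆⊆q : ∀ {x : Fin n} {p q : Subset n} → p ⊆ q - x → x ∈ q → p ∪ ⁅ x ⁆ ⊆ q
p⊆q-x⇒p∪⁅x⁆⊆q {p = p} p⊆q-x x∈q y∈p∪⁅x⁆ =
  [ proj₁ ∘ x∈p-y⁻ ∘ p⊆q-x , (λ { refl → x∈q }) ]′ (x∈p∪⁅y⁆⁻ p y∈p∪⁅x⁆)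

Meets : Subset n → Subset n → Set
Meets p q = ∃ λ x → x ∈ p × x ∈ q

Meets-∷ : ∀ {s t} {p q : Subset n} → Meets p q → Meets (s ∷ p) (t ∷ q)
Meets-∷ (x , x∈p , x∈q) = suc x , Vec.there x∈p , Vec.there x∈q

∣p∪q∣≡∣p∣+∣q∣ : ∀ (p q : Subset n) → ¬ Meets p q → ∣ p ∪ q ∣ ≡ ∣ p ∣ + ∣ q ∣
∣p∪q∣≡∣p∣+∣q∣ []            []            _  = refl
∣p∪q∣≡∣p∣+∣q∣ (inside ∷ p)  (inside ∷ q)  p∦q = ⊥-elim (p∦q (zero , Vec.here , Vec.here))
∣p∪q∣≡∣p∣+∣q∣ (inside ∷ p)  (outside ∷ q) p∦q = cong suc (∣p∪q∣≡∣p∣+∣q∣ p q (p∦q ∘ Meets-∷))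
∣p∪q∣≡∣p∣+∣q∣ (outside ∷ p) (inside ∷ q)  p∦q =
  trans (cong suc (∣p∪q∣≡∣p∣+∣q∣ p q (p∦q ∘ Meets-∷))) (sym (ℕ.+-suc ∣ p ∣ ∣ q ∣))
∣p∪q∣≡∣p∣+∣q∣ (outside ∷ p) (outside ∷ q) p∦q = ∣p∪q∣≡∣p∣+∣q∣ p q (p∦q ∘ Meets-∷)

partition-size : ∀ {p q r : Subset n} →
                 (∀ {x} → x ∈ p → x ∈ q ⊎ x ∈ r) → (∀ {x} → x ∈ q ⊎ x ∈ r → x ∈ p) → ¬ Meets q r →
                 ∣ p ∣ ≡ ∣ q ∣ + ∣ r ∣
partition-size {p = p} {q} {r} p⊆q∪r q∪r⊆p q∦r =
  trans (cong ∣_∣ (⊆-antisym (x∈p∪q⁺ ∘ p⊆q∪r) (q∪r⊆p ∘ x∈p∪q⁻ q r))) (∣p∪q∣≡∣p∣+∣q∣ q r q∦r)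

x∈p⇒∣p∣≡1+∣p-x∣ : ∀ {x : Fin n} (p : Subset n) → x ∈ p → ∣ p ∣ ≡ suc ∣ p - x ∣
x∈p⇒∣p∣≡1+∣p-x∣ {x = x} p x∈p =
  trans (partition-size split join disjoint) (cong (_+ ∣ p - x ∣) (∣⁅x⁆∣≡1 x))
  where
  split : ∀ {y} → y ∈ p → y ∈ ⁅ x ⁆ ⊎ y ∈ p - x
  split {y} y∈p with y ≟ x
  ... | yes refl = inj₁ (x∈⁅x⁆ x)
  ... | no y≢x   = inj₂ (x∈p∧x≢y⇒x∈p-y y∈p y≢x)
  join : ∀ {y} → y ∈ ⁅ x ⁆ ⊎ y ∈ p - x → y ∈ p
  join (inj₁ y∈⁅x⁆) = subst (_∈ p) (sym (x∈⁅y⁆⇒x≡y x y∈⁅x⁆)) x∈p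
  join (inj₂ y∈p-x) = proj₁ (x∈p-y⁻ {p = p} y∈p-x)
  disjoint : ¬ Meets ⁅ x ⁆ (p - x)
  disjoint (y , y∈⁅x⁆ , y∈p-x) = proj₂ (x∈p-y⁻ {p = p} y∈p-x) (x∈⁅y⁆⇒x≡y x y∈⁅x⁆)

∣p∣≡1+k⇒∣p-x∣≡k : ∀ {x : Fin n} {k} (p : Subset n) → x ∈ p → ∣ p ∣ ≡ suc k → ∣ p - x ∣ ≡ k
∣p∣≡1+k⇒∣p-x∣≡k p x∈p ∣p∣≡1+k = ℕ.suc-injective (trans (sym (x∈p⇒∣p∣≡1+∣p-x∣ p x∈p)) ∣p∣≡1+k)

∣p∣≡1+k⇒Nonempty : ∀ (p : Subset n) {k} → ∣ p ∣ ≡ suc k → Nonempty p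
∣p∣≡1+k⇒Nonempty (inside ∷ p)  _   = zero , Vec.here
∣p∣≡1+k⇒Nonempty (outside ∷ p) eq = let x , x∈p = ∣p∣≡1+k⇒Nonempty p eq in suc x , Vec.there x∈p

∣p∣≡0⇒x∉p : ∀ {x : Fin n} (p : Subset n) → ∣ p ∣ ≡ 0 → x ∉ p
∣p∣≡0⇒x∉p {x = x} p ∣p∣≡0 x∈p = ℕ.n≮0 (subst (∣ p - x ∣ <_) ∣p∣≡0 (x∈p⇒∣p-x∣<∣p∣ x∈p))

IsPair : Subset n → Set
IsPair {n} e = ∃₂ λ (a b : Fin n) → a ≢ b × a ∈ e × b ∈ e × (∀ {x} → x ∈ e → x ≡ a ⊎ x ≡ b)

∣p-a-b∣≡0⇒x≡a⊎x≡b : ∀ {a b x : Fin n} (p : Subset n) → ∣ p - a - b ∣ ≡ 0 → x ∈ p → x ≡ a ⊎ x ≡ b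
∣p-a-b∣≡0⇒x≡a⊎x≡b {a = a} {b} {x} p ∣p-a-b∣≡0 x∈p with x ≟ a | x ≟ b
... | yes x≡a | _       = inj₁ x≡a
... | no _    | yes x≡b = inj₂ x≡b
... | no x≢a  | no x≢b  =
  ⊥-elim (∣p∣≡0⇒x∉p (p - a - b) ∣p-a-b∣≡0 (x∈p∧x≢y⇒x∈p-y (x∈p∧x≢y⇒x∈p-y x∈p x≢a) x≢b))

∣p∣≡2⇒IsPair : ∀ (p : Subset n) → ∣ p ∣ ≡ 2 → IsPair p
∣p∣≡2⇒IsPair p ∣p∣≡2 =
  let a , a∈p   = ∣p∣≡1+k⇒Nonempty p ∣p∣≡2
      ∣p-a∣≡1   = ∣p∣≡1+k⇒∣p-x∣≡k p a∈p ∣p∣≡2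
      b , b∈p-a = ∣p∣≡1+k⇒Nonempty (p - a) ∣p-a∣≡1
      b∈p , b≢a = x∈p-y⁻ {p = p} b∈p-a
  in a , b , b≢a ∘ sym , a∈p , b∈p , ∣p-a-b∣≡0⇒x≡a⊎x≡b p (∣p∣≡1+k⇒∣p-x∣≡k (p - a) b∈p-a ∣p-a∣≡1)

pair-cases : ∀ {g : Subset n} {p q x} → IsPair g → p ∈ g → q ∈ g → p ≢ q → x ∈ g → x ≡ p ⊎ x ≡ q
pair-cases (_ , _ , _ , _ , _ , only) p∈g q∈g p≢q x∈g
  with only p∈g | only q∈g | only x∈g
... | inj₁ refl | inj₁ refl | _         = ⊥-elim (p≢q refl)
... | inj₂ refl | inj₂ refl | _         = ⊥-elim (p≢q refl)
... | inj₁ refl | inj₂ refl | inj₁ refl = inj₁ refl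
... | inj₁ refl | inj₂ refl | inj₂ refl = inj₂ refl
... | inj₂ refl | inj₁ refl | inj₁ refl = inj₂ refl
... | inj₂ refl | inj₁ refl | inj₂ refl = inj₁ refl

pair-partner : ∀ {g : Subset n} {y} → IsPair g → y ∈ g → ∃ λ t → t ∈ g × y ≢ t
pair-partner (a , b , a≢b , a∈g , b∈g , only) y∈g with only y∈g
... | inj₁ refl = b , b∈g , a≢b
... | inj₂ refl = a , a∈g , a≢b ∘ sym

-- Facets, deletion and link

facet-above : ∀ {P : Subset n → Set} → Decidable P → ∀ {G} → P G → ∃ λ F → G ⊆ F × Facet P F
facet-above {n} {P} P? {G} = climb n (ℕ.m≤m+n n ∣ G ∣)
  where
  climb : ∀ k {G} → n ≤ k + ∣ G ∣ → P G → ∃ λ F → G ⊆ F × Facet P F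
  climb k {G} n≤k+∣G∣ PG with anySubset? (λ H → P? H ×-dec G ⊂? H)
  ... | no ∄H = G , (λ x∈G → x∈G) , PG , maximal
    where
    maximal : ∀ H → P H → G ⊆ H → H ≡ G
    maximal H PH G⊆H = ⊆-antisym H⊆G G⊆H
      where
      H⊆G : H ⊆ G
      H⊆G {x} x∈H with x ∈? G
      ... | yes x∈G = x∈G
      ... | no x∉G  = ⊥-elim (∄H (H , PH , G⊆H , x , x∈H , x∉G))
  climb zero    {G} n≤∣G∣ PG | yes (H , PH , G⊂H) =
    ⊥-elim (ℕ.<⇒≱ (ℕ.<-≤-trans (p⊂q⇒∣p∣<∣q∣ G⊂H) (∣p∣≤n H)) n≤∣G∣)
  climb (suc k) {G} n≤k+∣G∣ PG | yes (H , PH , G⊂H) =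
    let F , H⊆F , facet = climb k n≤k+∣H∣ PH in F , H⊆F ∘ proj₁ G⊂H , facet
    where
    n≤k+∣H∣ : n ≤ k + ∣ H ∣
    n≤k+∣H∣ = ℕ.≤-trans n≤k+∣G∣ (ℕ.≤-trans (ℕ.≤-reflexive (sym (ℕ.+-suc k ∣ G ∣)))
                                              (ℕ.+-monoʳ-≤ k (p⊂q⇒∣p∣<∣q∣ G⊂H)))

T-not-lookup-∧ : ∀ (G : Subset n) v b → T (not (lookup G v) ∧ b) ⇔ (v ∉ G × T b)
T-not-lookup-∧ G v b with lookup G v in eq
... | true  = mk⇔ (λ ()) (λ (v∉G , _) → v∉G (lookup⇒[]= v G eq))
... | false = mk⇔ (λ Tb → (λ v∈G → true≢false (trans (sym ([]=⇒lookup v∈G)) eq)) , Tb) proj₂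
  where
  true≢false : true ≢ false
  true≢false ()

face-del : ∀ (Δ : Complex n) v → Face (del Δ v) ≐′ (λ G → v ∉ G × Face Δ G)
face-del Δ v = (λ G → to (T-not-lookup-∧ G v (Δ G))) , (λ G → from (T-not-lookup-∧ G v (Δ G)))

face-lk : ∀ (Δ : Complex n) v → Face (lk Δ v) ≐′ (λ G → v ∉ G × Face Δ (G ∪ ⁅ v ⁆))
face-lk Δ v = (λ G → to (T-not-lookup-∧ G v (Δ (G ∪ ⁅ v ⁆))))
            , (λ G → from (T-not-lookup-∧ G v (Δ (G ∪ ⁅ v ⁆))))

simplex-vd : ∀ {Δ : Complex n} {W} → Face Δ ≐′ (_⊆ W) → VertexDecomposable Δ
simplex-vd (Δ⊆2^W , 2^W⊆Δ) = simplex (inj₂ (_ , λ G → mk⇔ (Δ⊆2^W G) (2^W⊆Δ G)))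

del-facet⇒facet : ∀ (Δ : Complex n) v {F} → Facet (Face (del Δ v)) F →
                  (∀ {G} → Face Δ G → F ⊆ G → v ∉ G) → Facet (Face Δ) F
del-facet⇒facet Δ v {F} (F∈del , maximal) v∉ =
  proj₂ (proj₁ (face-del Δ v) F F∈del) ,
  λ G G∈Δ F⊆G → maximal G (proj₂ (face-del Δ v) G (v∉ G∈Δ F⊆G , G∈Δ)) F⊆G

-- The complex generated by the sets S - u, for the u ∈ S satisfying P

OmitsSome : (Fin n → Set) → Subset n → Subset n → Set
OmitsSome P S G = G ⊆ S × ∃ λ u → P u × u ∈ S × u ∉ G

module OmitsSomeAt {P : Fin n → Set} {S : Subset n} {Δ : Complex n} (faces : Face Δ ≐′ OmitsSome P S)
                   {u : Fin n} (Pu : P u) (u∈S : u ∈ S) where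

  ⊆S-u⇒omits : ∀ {G} → G ⊆ S - u → OmitsSome P S G
  ⊆S-u⇒omits G⊆S-u =
    proj₁ ∘ x∈p-y⁻ ∘ G⊆S-u , u , Pu , u∈S , p⊆q-x⇒x∉p G⊆S-u

  face-del-at : Face (del Δ u) ≐′ (_⊆ S - u)
  face-del-at = del⇒ , ⇒del
    where
    del⇒ : ∀ G → Face (del Δ u) G → G ⊆ S - u
    del⇒ G G∈del with proj₁ (face-del Δ u) G G∈del
    ... | u∉G , G∈Δ = p⊆q⇒p⊆q-x (proj₁ (proj₁ faces G G∈Δ)) u∉G
    ⇒del : ∀ G → G ⊆ S - u → Face (del Δ u) G
    ⇒del G G⊆S-u = proj₂ (face-del Δ u) G (p⊆q-x⇒x∉p G⊆S-u , proj₂ faces G (⊆S-u⇒omits G⊆S-u))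

  face-lk-at : Face (lk Δ u) ≐′ OmitsSome P (S - u)
  face-lk-at = lk⇒ , ⇒lk
    where
    lk⇒ : ∀ G → Face (lk Δ u) G → OmitsSome P (S - u) G
    lk⇒ G G∈lk with proj₁ (face-lk Δ u) G G∈lk
    ... | u∉G , G+u∈Δ with proj₁ faces _ G+u∈Δ
    ... | G+u⊆S , w , Pw , w∈S , w∉G+u =
      p⊆q⇒p⊆q-x (G+u⊆S ∘ x∈p∪q⁺ ∘ inj₁) u∉G ,
      w , Pw , x∈p∧x≢y⇒x∈p-y w∈S (λ { refl → w∉G+u (x∈p∪q⁺ (inj₂ (x∈⁅x⁆ u))) }) ,
      w∉G+u ∘ x∈p∪q⁺ ∘ inj₁
    ⇒lk : ∀ G → OmitsSome P (S - u) G → Face (lk Δ u) G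
    ⇒lk G (G⊆S-u , w , Pw , w∈S-u , w∉G) =
      proj₂ (face-lk Δ u) G
        (p⊆q-x⇒x∉p G⊆S-u , proj₂ faces _ (p⊆q-x⇒p∪⁅x⁆⊆q G⊆S-u u∈S , w , Pw , w∈S , w∉G+u))
      where
      w∈S : w ∈ S
      w∈S = proj₁ (x∈p-y⁻ w∈S-u)
      w∉G+u : w ∉ G ∪ ⁅ u ⁆
      w∉G+u w∈G+u = [ w∉G , proj₂ (x∈p-y⁻ w∈S-u) ]′ (x∈p∪⁅y⁆⁻ G w∈G+u)

  del-facets-are-facets : ∀ F → Facet (Face (del Δ u)) F → Facet (Face Δ) F
  del-facets-are-facets F facet@(F∈del , maximal) = del-facet⇒facet Δ u facet u∉
    where
    S-u≡F : S - u ≡ F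
    S-u≡F = maximal (S - u) (proj₂ face-del-at _ (λ x → x)) (proj₁ face-del-at F F∈del)
    u∉ : ∀ {G} → Face Δ G → F ⊆ G → u ∉ G
    u∉ G∈Δ F⊆G u∈G with proj₁ faces _ G∈Δ
    ... | _ , w , _ , w∈S , w∉G with w ≟ u
    ...   | yes refl = w∉G u∈G
    ...   | no w≢u   = w∉G (F⊆G (subst (w ∈_) S-u≡F (x∈p∧x≢y⇒x∈p-y w∈S w≢u)))

omitsSome-vd : ∀ {P : Fin n → Set} → Decidable P → ∀ k {S} → ∣ S ∣ ≤ k →
               ∀ {Δ : Complex n} → Face Δ ≐′ OmitsSome P S → VertexDecomposable Δ
omitsSome-vd P? k {S} ∣S∣≤k {Δ} faces with any? (λ u → P? u ×-dec u ∈? S)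
... | no ∄u = simplex (inj₁ λ G G∈Δ → let _ , u , Pu , u∈S , _ = proj₁ faces G G∈Δ in ∄u (u , Pu , u∈S))
... | yes (u , Pu , u∈S) with any? (λ w → P? w ×-dec w ∈? S ×-dec ¬? (w ≟ u))
...   | no ∄w = simplex-vd {Δ = Δ} (only-u , λ G → proj₂ faces G ∘ ⊆S-u⇒omits)
  where
  open OmitsSomeAt faces Pu u∈S
  only-u : ∀ G → Face Δ G → G ⊆ S - u
  only-u G G∈Δ {x} x∈G with proj₁ faces G G∈Δ
  ... | G⊆S , w , Pw , w∈S , w∉G with w ≟ u
  ...   | yes refl = p⊆q⇒p⊆q-x G⊆S w∉G x∈G
  ...   | no w≢u   = ⊥-elim (∄w (w , Pw , w∈S , w≢u))
omitsSome-vd P? (suc k) {S} ∣S∣≤k {Δ} faces | yes (u , Pu , u∈S) | yes (w , Pw , w∈S , w≢u) =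
  decomp u u-face (simplex-vd face-del-at) link-vd del-facets-are-facets
  where
  open OmitsSomeAt faces Pu u∈S
  u-face : Face Δ ⁅ u ⁆
  u-face = proj₂ faces _ ( (λ x∈⁅u⁆ → subst (_∈ S) (sym (x∈⁅y⁆⇒x≡y u x∈⁅u⁆)) u∈S)
                         , w , Pw , w∈S , w≢u ∘ x∈⁅y⁆⇒x≡y u)
  link-vd : VertexDecomposable (lk Δ u)
  link-vd = omitsSome-vd P? k (ℕ.≤-pred (ℕ.≤-trans (x∈p⇒∣p-x∣<∣p∣ u∈S) ∣S∣≤k)) face-lk-at
omitsSome-vd P? zero {S} ∣S∣≤0 {Δ} faces | yes (u , Pu , u∈S) | yes _ =
  ⊥-elim (ℕ.n≮0 (ℕ.<-≤-trans (x∈p⇒∣p-x∣<∣p∣ u∈S) ∣S∣≤0))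

-- Graphs in shelling order

Adjacent : List (Subset n) → Fin n → Fin n → Set
Adjacent R v u = ∃ λ e → e ∈ₗ R × v ∈ e × u ∈ e × v ≢ u

OnEdge : List (Subset n) → Fin n → Set
OnEdge R v = ∃ λ e → e ∈ₗ R × v ∈ e

Shedding : List (Subset n) → Fin n → Set
Shedding R v = OnEdge R v × (∀ e → e ∈ₗ R → v ∉ e → ∃ λ u → u ∈ e × Adjacent R v u)

Near : List (Subset n) → Subset n → Fin n → Set
Near R e v = v ∈ e ⊎ ∃ λ u → u ∈ e × Adjacent R v u

Linked : Subset n → List (Subset n) → Set
Linked e R = ∀ f → f ∈ₗ R → ¬ Meets f e → ∃ λ g → g ∈ₗ R × Meets g f × Meets g e

-- Edges are listed newest first: each edge is linked to the older ones.
ShellingOrder : List (Subset n) → Set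
ShellingOrder []      = ⊤
ShellingOrder (e ∷ R) = Linked e R × ShellingOrder R

SheddingNeighbours : List (Subset n) → Set
SheddingNeighbours R = ∀ {x} → OnEdge R x → ∃ λ y → Adjacent R x y × Shedding R y

∃∈? : ∀ {A : Set} {P : A → Set} → Decidable P → ∀ xs → Dec (∃ λ x → x ∈ₗ xs × P x)
∃∈? P? xs = map′ find (λ (_ , x∈xs , Px) → lose x∈xs Px) (Any.any? P? xs)

∀∈? : ∀ {A : Set} {P : A → Set} → Decidable P → ∀ xs → Dec (∀ x → x ∈ₗ xs → P x)
∀∈? P? xs = map′ (λ Ps _ → All.lookup Ps) (λ Ps → All.tabulate (Ps _)) (All.all? P? xs)

adjacent? : ∀ (R : List (Subset n)) v → Decidable (Adjacent R v)
adjacent? R v u = ∃∈? (λ e → v ∈? e ×-dec u ∈? e ×-dec ¬? (v ≟ u)) R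

onEdge? : ∀ (R : List (Subset n)) → Decidable (OnEdge R)
onEdge? R v = ∃∈? (v ∈?_) R

shedding? : ∀ (R : List (Subset n)) → Decidable (Shedding R)
shedding? R v = onEdge? R v ×-dec ∀∈? (λ e → ¬? (v ∈? e) →-dec any? (λ u → u ∈? e ×-dec adjacent? R v u)) R

near? : ∀ (R : List (Subset n)) e → Decidable (Near R e)
near? R e v = v ∈? e ⊎-dec any? (λ u → u ∈? e ×-dec adjacent? R v u)

Adjacent-sym : ∀ {R : List (Subset n)} {v u} → Adjacent R v u → Adjacent R u v
Adjacent-sym (e , e∈R , v∈e , u∈e , v≢u) = e , e∈R , u∈e , v∈e , v≢u ∘ sym

Adjacent-mono : ∀ {R R′ : List (Subset n)} {v u} → (∀ {g} → g ∈ₗ R → g ∈ₗ R′) → Adjacent R v u → Adjacent R′ v u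
Adjacent-mono R⊆R′ (e , e∈R , v∈e , u∈e , v≢u) = e , R⊆R′ e∈R , v∈e , u∈e , v≢u

Adjacent⇒OnEdge : ∀ {R : List (Subset n)} {v u} → Adjacent R v u → OnEdge R v
Adjacent⇒OnEdge (e , e∈R , v∈e , _) = e , e∈R , v∈e

Shedding-∷ : ∀ {e : Subset n} {R y} → Shedding R y → Near R e y → Shedding (e ∷ R) y
Shedding-∷ {e = e} {R} {y} ((g , g∈R , y∈g) , neighbour) near = (g , there g∈R , y∈g) , neighbour′
  where
  neighbour′ : ∀ g → g ∈ₗ e ∷ R → y ∉ g → ∃ λ u → u ∈ g × Adjacent (e ∷ R) y u
  neighbour′ g (here refl) y∉e = [ ⊥-elim ∘ y∉e , (λ (u , u∈e , y~u) → u , u∈e , Adjacent-mono there y~u) ]′ near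
  neighbour′ g (there g∈R) y∉g = let u , u∈g , y~u = neighbour g g∈R y∉g in u , u∈g , Adjacent-mono there y~u

Untouched : (Fin n → Set) → Subset n → Set
Untouched Q g = ¬ ∃ λ v → v ∈ g × Q v

untouched? : ∀ {Q : Fin n → Set} → Decidable Q → Decidable (Untouched Q)
untouched? Q? g = ¬? (any? (λ v → v ∈? g ×-dec Q? v))

touching-vertex : ∀ {Q : Fin n → Set} → Decidable Q → ∀ {g} → ¬ Untouched Q g → ∃ λ v → v ∈ g × Q v
touching-vertex Q? {g} touched with any? (λ v → v ∈? g ×-dec Q? v)
... | yes v = v
... | no ∄v = ⊥-elim (touched ∄v)

prune : ∀ {Q : Fin n → Set} → Decidable Q → List (Subset n) → List (Subset n)
prune Q? = filter (untouched? Q?)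

∈-prune⁻ : ∀ {Q : Fin n → Set} (Q? : Decidable Q) R {g} → g ∈ₗ prune Q? R → g ∈ₗ R × Untouched Q g
∈-prune⁻ Q? R = ∈-filter⁻ (untouched? Q?) {xs = R}

∈-prune⁺ : ∀ {Q : Fin n → Set} (Q? : Decidable Q) {R g} → g ∈ₗ R → Untouched Q g → g ∈ₗ prune Q? R
∈-prune⁺ Q? = ∈-filter⁺ (untouched? Q?)

prune-shellingOrder : ∀ {Q : Fin n → Set} (Q? : Decidable Q) {R} → All IsPair R → ShellingOrder R →
                      ShellingOrder (prune Q? R)
prune-shellingOrder Q? {[]} _ _ = tt
prune-shellingOrder {Q = Q} Q? {e ∷ R} (_ ∷ pairs) (linked , shelling)
  with any? (λ v → v ∈? e ×-dec Q? v)
... | yes _          = prune-shellingOrder Q? pairs shelling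
... | no e-untouched = linked′ , prune-shellingOrder Q? pairs shelling
  where
  linked′ : Linked e (prune Q? R)
  linked′ f f∈R′ f∦e with ∈-prune⁻ Q? R f∈R′
  ... | f∈R , f-untouched with linked f f∈R f∦e
  ... | g , g∈R , (p , p∈g , p∈f) , (q , q∈g , q∈e) =
    g , ∈-prune⁺ Q? g∈R g-untouched , (p , p∈g , p∈f) , (q , q∈g , q∈e)
    where
    g-untouched : Untouched Q g
    g-untouched (v , v∈g , Qv)
      with pair-cases (All.lookup pairs g∈R) p∈g q∈g (λ { refl → f∦e (p , p∈f , q∈e) }) v∈g
    ... | inj₁ refl = f-untouched (v , p∈f , Qv)
    ... | inj₂ refl = e-untouched (v , q∈e , Qv)

module SheddingStep {e : Subset n} {R : List (Subset n)}
         (pairs : All IsPair (e ∷ R)) (linked : Linked e R) (shelling : ShellingOrder R)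
         (ih : ∀ {R′ : List (Subset n)} → length R′ ≤ length R → All IsPair R′ → ShellingOrder R′ →
               SheddingNeighbours R′)
         where

  e-pair : IsPair e
  e-pair = All.head pairs

  R-pairs : All IsPair R
  R-pairs = All.tail pairs

  pair : ∀ {g} → g ∈ₗ R → IsPair g
  pair = All.lookup R-pairs

  bridge : ∀ {f} → f ∈ₗ R → ¬ Meets f e → ∃₂ λ p q → p ∈ f × q ∈ e × Adjacent R p q
  bridge f∈R f∦e with linked _ f∈R f∦e
  ... | g , g∈R , (p , p∈g , p∈f) , (q , q∈g , q∈e) =
    p , q , p∈f , q∈e , (g , g∈R , p∈g , q∈g , λ { refl → f∦e (p , p∈f , q∈e) })

  old-endpoint : ∀ {x} → x ∈ e → OnEdge R x → ∃ λ y → Adjacent (e ∷ R) x y × Shedding (e ∷ R) y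
  old-endpoint {x} x∈e x∈R =
    let y , x~y , y-shedding = ih ℕ.≤-refl R-pairs shelling x∈R
    in y , Adjacent-mono there x~y , Shedding-∷ y-shedding (inj₂ (x , x∈e , Adjacent-sym x~y))

  -- If x occurs in no older edge, the other endpoint of e is shedding.
  new-endpoint : ∀ {x} → x ∈ e → ¬ OnEdge R x → ∃ λ y → Adjacent (e ∷ R) x y × Shedding (e ∷ R) y
  new-endpoint {x} x∈e x∉R with pair-partner e-pair x∈e
  ... | t , t∈e , x≢t = t , (e , here refl , x∈e , t∈e , x≢t) , (e , here refl , t∈e) , neighbour
    where
    neighbour : ∀ g → g ∈ₗ e ∷ R → t ∉ g → ∃ λ u → u ∈ g × Adjacent (e ∷ R) t u
    neighbour g (here refl) t∉e = ⊥-elim (t∉e t∈e)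
    neighbour g (there g∈R) t∉g with bridge g∈R g∦e
      where
      g∦e : ¬ Meets g e
      g∦e (z , z∈g , z∈e) with pair-cases e-pair x∈e t∈e x≢t z∈e
      ... | inj₁ refl = x∉R (g , g∈R , z∈g)
      ... | inj₂ refl = t∉g z∈g
    ... | p , q , p∈g , q∈e , p~q with pair-cases e-pair x∈e t∈e x≢t q∈e
    ...   | inj₁ refl = ⊥-elim (x∉R (Adjacent⇒OnEdge (Adjacent-sym p~q)))
    ...   | inj₂ refl = p , p∈g , Adjacent-mono there (Adjacent-sym p~q)

  module OffEdge {x : Fin n} (x∉e : x ∉ e) (x∈R : OnEdge R x) where

    Candidate : Fin n → Set
    Candidate v = Adjacent R x v × Shedding R v

    candidate? : Decidable Candidate
    candidate? v = adjacent? R x v ×-dec shedding? R v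

    -- Assuming no candidate is near e, pruning the candidates leads to a contradiction.
    module AllFar (far : ∀ {v} → Candidate v → ¬ Near R e v) where

      R′ : List (Subset n)
      R′ = prune candidate? R

      R′⊆R : ∀ {g} → g ∈ₗ R′ → g ∈ₗ R
      R′⊆R = proj₁ ∘ ∈-prune⁻ candidate? R

      -- The edge linking f to e survives the pruning.
      detour : ∀ {f y t} → f ∈ₗ R → y ∈ f → Candidate y → t ∈ f → y ≢ t →
               ∃ λ q → q ∈ e × Adjacent R′ t q
      detour {f} f∈R y∈f cy t∈f y≢t with bridge f∈R f∦e
        where
        f∦e : ¬ Meets f e
        f∦e (z , z∈f , z∈e) with pair-cases (pair f∈R) y∈f t∈f y≢t z∈f
        ... | inj₁ refl = far cy (inj₁ z∈e)
        ... | inj₂ refl = far cy (inj₂ (z , z∈e , (f , f∈R , y∈f , t∈f , y≢t)))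
      ... | p , q , p∈f , q∈e , p~q@(h , h∈R , p∈h , q∈h , p≢q)
        with pair-cases (pair f∈R) y∈f t∈f y≢t p∈f
      ...   | inj₁ refl = ⊥-elim (far cy (inj₂ (q , q∈e , p~q)))
      ...   | inj₂ refl = q , q∈e , (h , ∈-prune⁺ candidate? h∈R h-untouched , p∈h , q∈h , p≢q)
        where
        h-untouched : Untouched Candidate h
        h-untouched (v , v∈h , cv) with pair-cases (pair h∈R) p∈h q∈h p≢q v∈h
        ... | inj₁ refl = far cv (inj₂ (q , q∈e , p~q))
        ... | inj₂ refl = far cv (inj₁ q∈e)

      y₀-witness : ∃ λ y → Adjacent R x y × Shedding R y
      y₀-witness = ih ℕ.≤-refl R-pairs shelling x∈R

      x∈R′ : OnEdge R′ x
      x∈R′ with y₀-witness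
      ... | y₀ , x~y₀@(f , f∈R , x∈f , y₀∈f , x≢y₀) , y₀-shedding =
        Adjacent⇒OnEdge (proj₂ (proj₂ (detour f∈R y₀∈f (x~y₀ , y₀-shedding) x∈f (x≢y₀ ∘ sym))))

      z-witness : ∃ λ z → Adjacent R′ x z × Shedding R′ z
      z-witness = ih (length-filter (untouched? candidate?) R)
                     (All.filter⁺ (untouched? candidate?) R-pairs)
                     (prune-shellingOrder candidate? R-pairs shelling) x∈R′

      module Neighbour {z : Fin n} (x~z : Adjacent R′ x z) (z-shedding′ : Shedding R′ z) where

        z-not-candidate : ¬ Candidate z
        z-not-candidate cz =
          let h , h∈R′ , _ , z∈h , _ = x~z in proj₂ (∈-prune⁻ candidate? R h∈R′) (z , z∈h , cz)

        -- y is shedding, so it has a neighbour on the edge joining z and q, and that neighbour is not q.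
        adjacent-candidates : ∀ {y q} → Candidate y → q ∈ e → Adjacent R z q → Adjacent R z y
        adjacent-candidates {y} cy q∈e z~q@(g , g∈R , z∈g , q∈g , z≢q)
          with y ∈? g
        ... | yes y∈g with pair-cases (pair g∈R) z∈g q∈g z≢q y∈g
        ...   | inj₁ refl = ⊥-elim (z-not-candidate cy)
        ...   | inj₂ refl = ⊥-elim (far cy (inj₁ q∈e))
        adjacent-candidates {y} cy q∈e z~q@(g , g∈R , z∈g , q∈g , z≢q) | no y∉g
          with proj₂ (proj₂ cy) g g∈R y∉g
        ... | u , u∈g , y~u with pair-cases (pair g∈R) z∈g q∈g z≢q u∈g
        ...   | inj₁ refl = Adjacent-sym y~u
        ...   | inj₂ refl = ⊥-elim (far cy (inj₂ (u , q∈e , y~u)))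

        pruned-edge-neighbour : ∀ {g} → g ∈ₗ R → z ∉ g → ¬ Untouched Candidate g →
                                ∃ λ u → u ∈ g × Adjacent R z u
        pruned-edge-neighbour g∈R z∉g touched with touching-vertex candidate? touched
        ... | y , y∈g , cy with pair-partner (pair g∈R) y∈g
        ... | t , t∈g , y≢t with detour g∈R y∈g cy t∈g y≢t
        ... | q , q∈e , t~q@(h , h∈R′ , t∈h , q∈h , t≢q) with z ∈? h
        ...   | yes z∈h with pair-cases (pair (R′⊆R h∈R′)) t∈h q∈h t≢q z∈h
        ...     | inj₁ refl = ⊥-elim (z∉g t∈g)
        ...     | inj₂ refl = t , t∈g , Adjacent-mono R′⊆R (Adjacent-sym t~q)
        pruned-edge-neighbour g∈R z∉g touched
          | y , y∈g , cy | t , t∈g , y≢t | q , q∈e , (h , h∈R′ , t∈h , q∈h , t≢q) | no z∉h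
          with proj₂ z-shedding′ h h∈R′ z∉h
        ... | u , u∈h , z~u with pair-cases (pair (R′⊆R h∈R′)) t∈h q∈h t≢q u∈h
        ...   | inj₁ refl = t , t∈g , Adjacent-mono R′⊆R z~u
        ...   | inj₂ refl = y , y∈g , adjacent-candidates cy q∈e (Adjacent-mono R′⊆R z~u)

        z-shedding : Shedding R z
        z-shedding = Adjacent⇒OnEdge (Adjacent-sym (Adjacent-mono R′⊆R x~z)) , neighbour
          where
          neighbour : ∀ g → g ∈ₗ R → z ∉ g → ∃ λ u → u ∈ g × Adjacent R z u
          neighbour g g∈R z∉g with untouched? candidate? g
          ... | no touched = pruned-edge-neighbour g∈R z∉g touched
          ... | yes untouched with proj₂ z-shedding′ g (∈-prune⁺ candidate? g∈R untouched) z∉g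
          ...   | u , u∈g , z~u = u , u∈g , Adjacent-mono R′⊆R z~u

        contradiction : ⊥
        contradiction = z-not-candidate (Adjacent-mono R′⊆R x~z , z-shedding)

      contradiction : ⊥
      contradiction = Neighbour.contradiction (proj₁ (proj₂ z-witness)) (proj₂ (proj₂ z-witness))

    neighbour : ∃ λ y → Adjacent (e ∷ R) x y × Shedding (e ∷ R) y
    neighbour with any? (λ v → candidate? v ×-dec near? R e v)
    ... | yes (v , (x~v , v-shedding) , near) = v , Adjacent-mono there x~v , Shedding-∷ v-shedding near
    ... | no ∄v = ⊥-elim (AllFar.contradiction (λ cv near → ∄v (_ , cv , near)))

  neighbours : SheddingNeighbours (e ∷ R)
  neighbours {x} x∈eR with x ∈? e
  ... | yes x∈e with onEdge? R x
  ...   | yes x∈R = old-endpoint x∈e x∈R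
  ...   | no x∉R  = new-endpoint x∈e x∉R
  neighbours {x} (g , here refl , x∈e) | no x∉e = ⊥-elim (x∉e x∈e)
  neighbours {x} (g , there g∈R , x∈g) | no x∉e = OffEdge.neighbour x∉e (g , g∈R , x∈g)

sheddingNeighbours : ∀ k (R : List (Subset n)) → length R ≤ k → All IsPair R → ShellingOrder R →
                     SheddingNeighbours R
sheddingNeighbours k [] _ _ _ (_ , () , _)
sheddingNeighbours (suc k) (e ∷ R) (s≤s ∣R∣≤k) pairs (linked , shelling) =
  SheddingStep.neighbours pairs linked shelling
    (λ ∣R′∣≤∣R∣ → sheddingNeighbours k _ (ℕ.≤-trans ∣R′∣≤∣R∣ ∣R∣≤k))

-- The complex generated by the complements in S of the edges of a graph

AvoidsEdge : List (Subset n) → Subset n → Subset n → Set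
AvoidsEdge R S G = G ⊆ S × ∃ λ e → e ∈ₗ R × ¬ Meets e G

module AvoidsEdgeAt {R : List (Subset n)} (pairs : All IsPair R) {S : Subset n} (R⊆S : ∀ {e} → e ∈ₗ R → e ⊆ S)
                    {Δ : Complex n} (faces : Face Δ ≐′ AvoidsEdge R S) {v : Fin n} (shedding : Shedding R v)
                    where

  v∈S : v ∈ S
  v∈S = let g , g∈R , v∈g = proj₁ shedding in R⊆S g∈R v∈g

  omits⇒avoids : ∀ {G} → OmitsSome (Adjacent R v) (S - v) G → AvoidsEdge R S G
  omits⇒avoids {G} (G⊆S-v , u , (g , g∈R , v∈g , u∈g , v≢u) , _ , u∉G) =
    proj₁ ∘ x∈p-y⁻ ∘ G⊆S-v , g , g∈R , g∦G
    where
    g∦G : ¬ Meets g G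
    g∦G (x , x∈g , x∈G) with pair-cases (All.lookup pairs g∈R) v∈g u∈g v≢u x∈g
    ... | inj₁ refl = proj₂ (x∈p-y⁻ (G⊆S-v x∈G)) refl
    ... | inj₂ refl = u∉G x∈G

  avoids⇒omits : ∀ {G} → v ∉ G → AvoidsEdge R S G → OmitsSome (Adjacent R v) (S - v) G
  avoids⇒omits {G} v∉G (G⊆S , g , g∈R , g∦G) =
    p⊆q⇒p⊆q-x G⊆S v∉G , omitted
    where
    in-S-v : ∀ {u} → u ∈ g → v ≢ u → u ∈ S - v
    in-S-v u∈g v≢u = x∈p∧x≢y⇒x∈p-y (R⊆S g∈R u∈g) (v≢u ∘ sym)
    omitted : ∃ λ u → Adjacent R v u × u ∈ S - v × u ∉ G
    omitted with v ∈? g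
    ... | yes v∈g = let u , u∈g , v≢u = pair-partner (All.lookup pairs g∈R) v∈g
                    in u , (g , g∈R , v∈g , u∈g , v≢u) , in-S-v u∈g v≢u , λ u∈G → g∦G (u , u∈g , u∈G)
    ... | no v∉g  = let u , u∈g , v~u@(_ , _ , _ , _ , v≢u) = proj₂ shedding g g∈R v∉g
                    in u , v~u , in-S-v u∈g v≢u , λ u∈G → g∦G (u , u∈g , u∈G)

  face-del-at : Face (del Δ v) ≐′ OmitsSome (Adjacent R v) (S - v)
  face-del-at =
    (λ G G∈del → let v∉G , G∈Δ = proj₁ (face-del Δ v) G G∈del in avoids⇒omits v∉G (proj₁ faces G G∈Δ)) ,
    (λ G omits → proj₂ (face-del Δ v) G (p⊆q-x⇒x∉p (proj₁ omits) , proj₂ faces G (omits⇒avoids omits)))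

  R′ : List (Subset n)
  R′ = prune (_≟ v) R

  face-lk-at : Face (lk Δ v) ≐′ AvoidsEdge R′ (S - v)
  face-lk-at = lk⇒ , ⇒lk
    where
    lk⇒ : ∀ G → Face (lk Δ v) G → AvoidsEdge R′ (S - v) G
    lk⇒ G G∈lk with proj₁ (face-lk Δ v) G G∈lk
    ... | v∉G , G+v∈Δ with proj₁ faces _ G+v∈Δ
    ... | G+v⊆S , g , g∈R , g∦G+v =
      p⊆q⇒p⊆q-x (G+v⊆S ∘ x∈p∪q⁺ ∘ inj₁) v∉G ,
      g , ∈-prune⁺ (_≟ v) g∈R (λ { (_ , v∈g , refl) → g∦G+v (_ , v∈g , x∈p∪q⁺ (inj₂ (x∈⁅x⁆ v))) }) ,
      λ (x , x∈g , x∈G) → g∦G+v (x , x∈g , x∈p∪q⁺ (inj₁ x∈G))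
    ⇒lk : ∀ G → AvoidsEdge R′ (S - v) G → Face (lk Δ v) G
    ⇒lk G (G⊆S-v , g , g∈R′ , g∦G) with ∈-prune⁻ (_≟ v) R g∈R′
    ... | g∈R , v∉g = proj₂ (face-lk Δ v) G
                        (p⊆q-x⇒x∉p G⊆S-v , proj₂ faces _ (p⊆q-x⇒p∪⁅x⁆⊆q G⊆S-v v∈S , g , g∈R , g∦G+v))
      where
      g∦G+v : ¬ Meets g (G ∪ ⁅ v ⁆)
      g∦G+v (x , x∈g , x∈G+v) =
        [ (λ x∈G → g∦G (x , x∈g , x∈G)) , (λ x≡v → v∉g (x , x∈g , x≡v)) ]′ (x∈p∪⁅y⁆⁻ G x∈G+v)

  R′-pairs : All IsPair R′
  R′-pairs = All.filter⁺ (untouched? (_≟ v)) pairs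

  R′⊆S-v : ∀ {e} → e ∈ₗ R′ → e ⊆ S - v
  R′⊆S-v e∈R′ x∈e with ∈-prune⁻ (_≟ v) R e∈R′
  ... | e∈R , v∉e = x∈p∧x≢y⇒x∈p-y (R⊆S e∈R x∈e) (λ x≡v → v∉e (_ , x∈e , x≡v))

  ∣R′∣<∣R∣ : length R′ < length R
  ∣R′∣<∣R∣ = let g , g∈R , v∈g = proj₁ shedding
             in filter-notAll (untouched? (_≟ v)) R (lose g∈R λ g-untouched → g-untouched (v , v∈g , refl))

  v-face : ∀ {g} → g ∈ₗ R → v ∉ g → Face Δ ⁅ v ⁆
  v-face g∈R v∉g = proj₂ faces _ ( (λ x∈⁅v⁆ → subst (_∈ S) (sym (x∈⁅y⁆⇒x≡y v x∈⁅v⁆)) v∈S)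
                                 , _ , g∈R , λ (x , x∈g , x∈⁅v⁆) → v∉g (subst (_∈ _) (x∈⁅y⁆⇒x≡y v x∈⁅v⁆) x∈g))

  faces-at-cone : (∀ {g} → g ∈ₗ R → v ∈ g) → Face Δ ≐′ OmitsSome (Adjacent R v) (S - v)
  faces-at-cone v∈R =
    (λ G G∈Δ → let avoids@(_ , g , g∈R , g∦G) = proj₁ faces G G∈Δ
               in avoids⇒omits (λ v∈G → g∦G (v , v∈R g∈R , v∈G)) avoids) ,
    (λ G → proj₂ faces G ∘ omits⇒avoids)

  del-facets-are-facets : ∀ F → Facet (Face (del Δ v)) F → Facet (Face Δ) F
  del-facets-are-facets F facet@(F∈del , maximal) with proj₁ face-del-at F F∈del
  ... | F⊆S-v , u , v~u , u∈S-v , u∉F = del-facet⇒facet Δ v facet v∉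
    where
    S-v-u≡F : S - v - u ≡ F
    S-v-u≡F = maximal (S - v - u)
                (proj₂ face-del-at _ (proj₁ ∘ x∈p-y⁻ , u , v~u , u∈S-v , p⊆q-x⇒x∉p (λ x∈ → x∈)))
                (p⊆q⇒p⊆q-x F⊆S-v u∉F)
    v∉ : ∀ {G} → Face Δ G → F ⊆ G → v ∉ G
    v∉ {G} G∈Δ F⊆G v∈G with proj₁ faces G G∈Δ
    ... | _ , g , g∈R , g∦G with All.lookup pairs g∈R
    ... | c , d , c≢d , c∈g , d∈g , _ = c≢d (trans (only-u c∈g) (sym (only-u d∈g)))
      where
      only-u : ∀ {y} → y ∈ g → y ≡ u
      only-u {y} y∈g with y ≟ u
      ... | yes y≡u = y≡u
      ... | no y≢u  = ⊥-elim (g∦G (y , y∈g , F⊆G (subst (y ∈_) S-v-u≡F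
                        (x∈p∧x≢y⇒x∈p-y (x∈p∧x≢y⇒x∈p-y (R⊆S g∈R y∈g) λ { refl → g∦G (y , y∈g , v∈G) }) y≢u))))

avoidsEdge-vd : ∀ k (R : List (Subset n)) → length R ≤ k → All IsPair R → ShellingOrder R →
                ∀ {S} → (∀ {e} → e ∈ₗ R → e ⊆ S) → ∀ {Δ : Complex n} → Face Δ ≐′ AvoidsEdge R S →
                VertexDecomposable Δ
avoidsEdge-vd k [] _ _ _ _ faces =
  simplex (inj₁ λ G G∈Δ → let _ , _ , e∈[] , _ = proj₁ faces G G∈Δ in Any.¬Any[] e∈[])
avoidsEdge-vd zero (_ ∷ _) () _ _ _ _
avoidsEdge-vd (suc k) R@(e ∷ _) ∣R∣≤k pairs shelling {S} R⊆S {Δ} faces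
  with a , _ , _ , a∈e , _ ← All.head pairs
  with v , _ , shedding ← sheddingNeighbours (suc k) R ∣R∣≤k pairs shelling (e , here refl , a∈e)
  with ∃∈? (λ g → ¬? (v ∈? g)) R
... | no v-on-all = omitsSome-vd (adjacent? R v) _ ℕ.≤-refl (faces-at-cone v∈R)
  where
  open AvoidsEdgeAt pairs R⊆S faces shedding
  v∈R : ∀ {g} → g ∈ₗ R → v ∈ g
  v∈R {g} g∈R with v ∈? g
  ... | yes v∈g = v∈g
  ... | no v∉g  = ⊥-elim (v-on-all (g , g∈R , v∉g))
... | yes (g , g∈R , v∉g) =
  decomp v (v-face g∈R v∉g) (omitsSome-vd (adjacent? R v) _ ℕ.≤-refl face-del-at) link-vd del-facets-are-facets
  where
  open AvoidsEdgeAt pairs R⊆S faces shedding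
  link-vd : VertexDecomposable (lk Δ v)
  link-vd = avoidsEdge-vd k R′ (ℕ.≤-pred (ℕ.≤-trans ∣R′∣<∣R∣ ∣R∣≤k)) R′-pairs
                          (prune-shellingOrder (_≟ v) pairs shelling) R′⊆S-v face-lk-at

module ReverseShelling (E : Subset n → Subset n) where

  -- acc holds the images of the elements already passed, the most recent first.
  Earlier : List (Subset n) → (Fs : List (Subset n)) → Fin (length Fs) → Subset n → Set
  Earlier acc Fs k y = y ∈ₗ acc ⊎ ∃ λ i → toℕ i < toℕ k × y ≡ E (List.lookup Fs i)

  ShellsAfter : List (Subset n) → List (Subset n) → Set
  ShellsAfter acc Fs = ∀ k {y} → Earlier acc Fs k y → ¬ Meets y (E (List.lookup Fs k)) →
                       ∃ λ z → Earlier acc Fs k z × Meets z y × Meets z (E (List.lookup Fs k))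

  Earlier-shift : ∀ {acc F Fs k y} → Earlier (E F ∷ acc) Fs k y → Earlier acc (F ∷ Fs) (suc k) y
  Earlier-shift (inj₁ (here y≡EF))       = inj₂ (zero , s≤s z≤n , y≡EF)
  Earlier-shift (inj₁ (there y∈acc))     = inj₁ y∈acc
  Earlier-shift (inj₂ (i , i<k , y≡EFi)) = inj₂ (suc i , s≤s i<k , y≡EFi)

  Earlier-unshift : ∀ {acc F Fs k y} → Earlier acc (F ∷ Fs) (suc k) y → Earlier (E F ∷ acc) Fs k y
  Earlier-unshift (inj₁ y∈acc)                     = inj₁ (there y∈acc)
  Earlier-unshift (inj₂ (zero , _ , y≡EF))         = inj₁ (here y≡EF)
  Earlier-unshift (inj₂ (suc i , s≤s i<k , y≡EFi)) = inj₂ (i , i<k , y≡EFi)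

  reverseAcc-shellingOrder : ∀ Fs {acc} → ShellingOrder acc → ShellsAfter acc Fs →
                             ShellingOrder (reverseAcc acc (map E Fs))
  reverseAcc-shellingOrder []       shelling _     = shelling
  reverseAcc-shellingOrder (F ∷ Fs) {acc} shelling after =
    reverseAcc-shellingOrder Fs (linked , shelling) after′
    where
    linked : Linked (E F) acc
    linked f f∈acc f∦EF with after zero (inj₁ f∈acc) f∦EF
    ... | g , inj₁ g∈acc , g-meets = g , g∈acc , g-meets
    ... | g , inj₂ (_ , () , _) , _
    after′ : ShellsAfter (E F ∷ acc) Fs
    after′ k earlier y∦Ek with after (suc k) (Earlier-shift earlier) y∦Ek
    ... | z , z-earlier , z-meets = z , Earlier-unshift z-earlier , z-meets

Unique-lookup : ∀ {xs : List (Subset n)} → Unique xs → ∀ {i j} → toℕ i < toℕ j →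
                List.lookup xs i ≢ List.lookup xs j
Unique-lookup (x∉xs ∷ _) {zero}  {suc j} _         = All.lookup x∉xs (∈-lookup j)
Unique-lookup (_ ∷ unique) {suc i} {suc j} (s≤s i<j) = Unique-lookup unique i<j

face⊆vertexSet : ∀ {Δ : Complex n} → IsComplex Δ → ∀ {G} → Face Δ G → G ⊆ vertexSet Δ
face⊆vertexSet {Δ = Δ} isComplex {G} G∈Δ {x} x∈G =
  lookup⇒[]= x (vertexSet Δ) (trans (lookup∘tabulate _ x) (to T-≡ (isComplex G ⁅ x ⁆ ⁅x⁆⊆G G∈Δ)))
  where
  ⁅x⁆⊆G : ⁅ x ⁆ ⊆ G
  ⁅x⁆⊆G y∈⁅x⁆ = subst (_∈ G) (sym (x∈⁅y⁆⇒x≡y x y∈⁅x⁆)) x∈G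

-- The complement graph of a shellable complex

module ComplementGraph {d : ℕ} {Δ : Complex n} (isComplex : IsComplex Δ) (shellable : Shellable d Δ)
                       (card : ∣ vertexSet Δ ∣ ≡ d + 3) where

  S : Subset n
  S = vertexSet Δ

  pure : PureOfSize (suc d) (Face Δ)
  pure = proj₁ shellable

  Fs : List (Subset n)
  Fs = proj₁ (proj₂ shellable)

  unique : Unique Fs
  unique = proj₁ (proj₂ (proj₂ shellable))

  listed : ∀ G → G ∈ₗ Fs ⇔ Facet (Face Δ) G
  listed = proj₁ (proj₂ (proj₂ (proj₂ shellable)))

  restrictions-pure : ∀ k → 1 ≤ toℕ k → PureOfSize d (generatedBefore Fs k)
  restrictions-pure = proj₂ (proj₂ (proj₂ (proj₂ shellable)))

  F : Fin (length Fs) → Subset n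
  F = List.lookup Fs

  edge : Subset n → Subset n
  edge G = S ─ G

  facet-of : ∀ {G} → G ∈ₗ Fs → Facet (Face Δ) G
  facet-of = to (listed _)

  facet⊆S : ∀ {G} → G ∈ₗ Fs → G ⊆ S
  facet⊆S = face⊆vertexSet isComplex ∘ proj₁ ∘ facet-of

  ∣facet∣≡1+d : ∀ {G} → G ∈ₗ Fs → ∣ G ∣ ≡ suc d
  ∣facet∣≡1+d = proj₁ pure _ ∘ facet-of

  x∉edge⇒x∈ : ∀ {G x} → x ∈ S → x ∉ edge G → x ∈ G
  x∉edge⇒x∈ {G} {x} x∈S x∉edge with x ∈? G
  ... | yes x∈G = x∈G
  ... | no x∉G  = ⊥-elim (x∉edge (x∈p∧x∉q⇒x∈p─q x∈S x∉G))

  ∣edge∣≡2 : ∀ {G} → G ∈ₗ Fs → ∣ edge G ∣ ≡ 2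
  ∣edge∣≡2 {G} G∈Fs = ℕ.+-cancelˡ-≡ (suc d) _ _ (trans (sym ∣S∣≡∣G∣+∣edge∣) (trans card (ℕ.+-suc d 2)))
    where
    split : ∀ {x} → x ∈ S → x ∈ G ⊎ x ∈ edge G
    split {x} x∈S with x ∈? G
    ... | yes x∈G = inj₁ x∈G
    ... | no x∉G  = inj₂ (x∈p∧x∉q⇒x∈p─q x∈S x∉G)
    ∣S∣≡∣G∣+∣edge∣ : ∣ S ∣ ≡ suc d + ∣ edge G ∣
    ∣S∣≡∣G∣+∣edge∣ = trans (partition-size split [ facet⊆S G∈Fs , proj₁ ∘ x∈p─q⁻ ]′
                                             (λ (x , x∈G , x∈edge) → proj₂ (x∈p─q⁻ x∈edge) x∈G))
                           (cong (_+ ∣ edge G ∣) (∣facet∣≡1+d G∈Fs))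

  R : List (Subset n)
  R = reverse (map edge Fs)

  ∈R⁻ : ∀ {e} → e ∈ₗ R → ∃ λ G → G ∈ₗ Fs × e ≡ edge G
  ∈R⁻ = ∈-map⁻ edge ∘ Any.reverse⁻

  ∈R⁺ : ∀ {G} → G ∈ₗ Fs → edge G ∈ₗ R
  ∈R⁺ = Any.reverse⁺ ∘ ∈-map⁺ edge

  R-pairs : All IsPair R
  R-pairs = All.tabulate (λ e∈R → pair (∈R⁻ e∈R))
    where
    pair : ∀ {e} → (∃ λ G → G ∈ₗ Fs × e ≡ edge G) → IsPair e
    pair (G , G∈Fs , refl) = ∣p∣≡2⇒IsPair _ (∣edge∣≡2 G∈Fs)

  R⊆S : ∀ {e} → e ∈ₗ R → e ⊆ S
  R⊆S e∈R with ∈R⁻ e∈R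
  ... | G , _ , refl = proj₁ ∘ x∈p─q⁻

  faces : Face Δ ≐′ AvoidsEdge R S
  faces = face⇒ , ⇒face
    where
    face⇒ : ∀ G → Face Δ G → AvoidsEdge R S G
    face⇒ G G∈Δ with facet-above (λ H → T? (Δ H)) G∈Δ
    ... | H , G⊆H , H-facet =
      face⊆vertexSet isComplex G∈Δ , edge H , ∈R⁺ (from (listed H) H-facet) ,
      λ (x , x∈edge , x∈G) → proj₂ (x∈p─q⁻ x∈edge) (G⊆H x∈G)
    ⇒face : ∀ G → AvoidsEdge R S G → Face Δ G
    ⇒face G (G⊆S , e , e∈R , e∦G) with ∈R⁻ e∈R
    ... | H , H∈Fs , refl =
      isComplex H G (λ x∈G → x∉edge⇒x∈ (G⊆S x∈G) λ x∈edge → e∦G (_ , x∈edge , x∈G)) (proj₁ (facet-of H∈Fs))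

  generatedBefore? : ∀ k → Decidable (generatedBefore Fs k)
  generatedBefore? k G = any? (λ i → toℕ i ℕ.<? toℕ k ×-dec G ⊆? F i ∩ F k)

  restriction-facet : ∀ {i k} → toℕ i < toℕ k →
                      ∃ λ j → toℕ j < toℕ k × F i ∩ F k ⊆ F j × ∣ F j ∩ F k ∣ ≡ d
  restriction-facet {i} {k} i<k with facet-above (generatedBefore? k) (i , i<k , λ x∈ → x∈)
  ... | Φ , Fi∩Fk⊆Φ , Φ-facet@((j , j<k , Φ⊆Fj∩Fk) , maximal) =
    j , j<k , proj₁ ∘ x∈p∩q⁻ _ _ ∘ Φ⊆Fj∩Fk ∘ Fi∩Fk⊆Φ ,
    trans (cong ∣_∣ (maximal (F j ∩ F k) (j , j<k , λ x∈ → x∈) Φ⊆Fj∩Fk))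
          (proj₁ (restrictions-pure k (ℕ.≤-trans (s≤s z≤n) i<k)) Φ Φ-facet)

  -- Otherwise F j would be the disjoint union of F j ∩ F k and edge (F k), of size d + 2.
  edges-meet : ∀ {j k} → ∣ F j ∩ F k ∣ ≡ d → Meets (edge (F j)) (edge (F k))
  edges-meet {j} {k} ∣Fj∩Fk∣≡d with any? (λ x → x ∈? edge (F j) ×-dec x ∈? edge (F k))
  ... | yes meet = meet
  ... | no ∄x    = ⊥-elim (ℕ.1+n≢n (sym (ℕ.suc-injective (trans ∣Fj∣≡d+2 (ℕ.+-comm d 2)))))
    where
    Fj∈Fs : F j ∈ₗ Fs
    Fj∈Fs = ∈-lookup j
    Fk∈Fs : F k ∈ₗ Fs
    Fk∈Fs = ∈-lookup k
    split : ∀ {x} → x ∈ F j → x ∈ F j ∩ F k ⊎ x ∈ edge (F k)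
    split {x} x∈Fj with x ∈? F k
    ... | yes x∈Fk = inj₁ (x∈p∩q⁺ (x∈Fj , x∈Fk))
    ... | no x∉Fk  = inj₂ (x∈p∧x∉q⇒x∈p─q (facet⊆S Fj∈Fs x∈Fj) x∉Fk)
    join : ∀ {x} → x ∈ F j ∩ F k ⊎ x ∈ edge (F k) → x ∈ F j
    join (inj₁ x∈Fj∩Fk) = proj₁ (x∈p∩q⁻ _ _ x∈Fj∩Fk)
    join (inj₂ x∈edge)  = x∉edge⇒x∈ (proj₁ (x∈p─q⁻ x∈edge)) λ x∈edge′ → ∄x (_ , x∈edge′ , x∈edge)
    disjoint : ¬ Meets (F j ∩ F k) (edge (F k))
    disjoint (x , x∈Fj∩Fk , x∈edge) = proj₂ (x∈p─q⁻ x∈edge) (proj₂ (x∈p∩q⁻ _ _ x∈Fj∩Fk))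
    ∣Fj∣≡d+2 : suc d ≡ d + 2
    ∣Fj∣≡d+2 = trans (sym (∣facet∣≡1+d Fj∈Fs))
                 (trans (partition-size split join disjoint) (cong₂ _+_ ∣Fj∩Fk∣≡d (∣edge∣≡2 Fk∈Fs)))

  -- Otherwise F k ⊆ F j, so the two facets coincide.
  edges-meet′ : ∀ {i j k} → toℕ j < toℕ k → F i ∩ F k ⊆ F j → Meets (edge (F j)) (edge (F i))
  edges-meet′ {i} {j} {k} j<k Fi∩Fk⊆Fj with any? (λ x → x ∈? edge (F j) ×-dec x ∈? edge (F i))
  ... | yes meet = meet
  ... | no ∄x    = ⊥-elim (Unique-lookup unique j<k
                            (proj₂ (facet-of (∈-lookup k)) (F j) (proj₁ (facet-of (∈-lookup j))) Fk⊆Fj))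
    where
    Fk⊆Fj : F k ⊆ F j
    Fk⊆Fj {x} x∈Fk with x ∈? F j
    ... | yes x∈Fj = x∈Fj
    ... | no x∉Fj  = ⊥-elim (x∉Fj (Fi∩Fk⊆Fj (x∈p∩q⁺ (x∈Fi , x∈Fk))))
      where
      x∈S : x ∈ S
      x∈S = facet⊆S (∈-lookup k) x∈Fk
      x∈Fi : x ∈ F i
      x∈Fi = x∉edge⇒x∈ x∈S λ x∈edge-i → ∄x (x , x∈p∧x∉q⇒x∈p─q x∈S x∉Fj , x∈edge-i)

  open ReverseShelling edge

  R-shelling : ShellingOrder R
  R-shelling = reverseAcc-shellingOrder Fs tt shells
    where
    shells : ShellsAfter [] Fs
    shells k (inj₂ (i , i<k , refl)) _ with restriction-facet i<k
    ... | j , j<k , Fi∩Fk⊆Fj , ∣Fj∩Fk∣≡d =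
      edge (F j) , inj₂ (j , j<k , refl) , edges-meet′ j<k Fi∩Fk⊆Fj , edges-meet ∣Fj∩Fk∣≡d

theorem4p4 : ∀ (n d : ℕ) (Δ : Complex n) → IsComplex Δ → Shellable d Δ →
    ∣ vertexSet Δ ∣ ≡ d + 3 → VertexDecomposable Δ
theorem4p4 n d Δ isComplex shellable card =
  avoidsEdge-vd (length R) R ℕ.≤-refl R-pairs R-shelling R⊆S faces
  where
  open ComplementGraph isComplex shellable card
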